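{- Let $f(x)$ be a formal power series and let $(a_k)_{k\ge 0}$ be an arbitrary sequence. Then \[ \Phi\Big(\sum_{k\ge 0}a_k x^k f(x)^{k+1}\Big)=\sum_{k\ge 0}a_k x^k\,\Phi\big(f(x)\big)^{k+1}. \]
   Context: The run transform $\Phi$ is defined on formal power series $f(x)$ (over a commutative ring such as $\mathbb{Q}$) by $\Phi\big(f(x)\big)=\frac{1-x}{1-xy}\,f\!\left(\frac{x(1-x)}{1-xy}\right)$, a formal power series in $x,y$. The sums above are well defined as formal power series because of the factors $x^k$. -}

module Defs where

open import Data.Nat using (ℕ; zero; suc; _∸_; _≤ᵇ_; _≡ᵇ_)
open import Data.Bool using (if_then_else_)
open import Data.Rational using (ℚ; 0ℚ; 1ℚ; _+_; _*_; _-_; -_)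

Σ≤ : ℕ → (ℕ → ℚ) → ℚ
Σ≤ zero    g = g 0
Σ≤ (suc n) g = Σ≤ n g + g (suc n)

Series1 : Set
Series1 = ℕ → ℚ

one₁ : Series1
one₁ zero    = 1ℚ
one₁ (suc _) = 0ℚ

X₁ : Series1
X₁ 1 = 1ℚ
X₁ _ = 0ℚ

_⊗₁_ : Series1 → Series1 → Series1
(f ⊗₁ g) n = Σ≤ n (λ i → f i * g (n ∸ i))

pow₁ : Series1 → ℕ → Series1
pow₁ f zero    = one₁
pow₁ f (suc k) = f ⊗₁ pow₁ f k

-- Bivariate formal power series over ℚ:  F n m = [x^n y^m] F
Series2 : Set
Series2 = ℕ → ℕ → ℚ

one₂ : Series2
one₂ zero    zero    = 1ℚ
one₂ _       _       = 0ℚ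

X₂ : Series2
X₂ 1 0 = 1ℚ
X₂ _ _ = 0ℚ

_⊕₂_ : Series2 → Series2 → Series2
(F ⊕₂ G) n m = F n m + G n m

neg₂ : Series2 → Series2
neg₂ F n m = - F n m

_⊗₂_ : Series2 → Series2 → Series2
(F ⊗₂ G) n m = Σ≤ n (λ i → Σ≤ m (λ j → F i j * G (n ∸ i) (m ∸ j)))

pow₂ : Series2 → ℕ → Series2
pow₂ F zero    = one₂
pow₂ F (suc k) = F ⊗₂ pow₂ F k

-- 1 / (1 - x y) = Σ_j x^j y^j
geomXY : Series2
geomXY n m = if n ≡ᵇ m then 1ℚ else 0ℚ

oneMinusX : Series2
oneMinusX = one₂ ⊕₂ neg₂ X₂

argΦ : Series2
argΦ = X₂ ⊗₂ (oneMinusX ⊗₂ geomXY)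

-- Substitution f(G) = Σ_k f_k G^k for G with zero constant term in x
-- (x-order ≥ 1), so [x^n] only involves k ≤ n.  Used only with G = argΦ.
compose : Series1 → Series2 → Series2
compose f G n m = Σ≤ n (λ k → f k * pow₂ G k n m)

Φ : Series1 → Series2
Φ f = oneMinusX ⊗₂ (geomXY ⊗₂ compose f argΦ)

-- Σ_{k≥0} a_k x^k f(x)^{k+1}   (term k has x-order ≥ k, so [x^n] needs k ≤ n)
lhsSeries : (ℕ → ℚ) → Series1 → Series1
lhsSeries a f n = Σ≤ n (λ k → a k * (pow₁ X₁ k ⊗₁ pow₁ f (suc k)) n)

rhsSeries : (ℕ → ℚ) → Series1 → Series2
rhsSeries a f n m = Σ≤ n (λ k → a k * (pow₂ X₂ k ⊗₂ pow₂ (Φ f) (suc k)) n m)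

-- Write ρ = (1 - x)/(1 - xy), so that the substituted series is x ρ and Φ f = ρ · f(x ρ).
-- Since x ρ has no constant term in x, substitution g ↦ g(x ρ) is a ring homomorphism which
-- commutes with sums Σ_k W_k in which x^k divides W_k.  Hence Φ is linear and continuous in
-- this sense, and on a single term
--   Φ(x^k f^(k+1)) = ρ (x ρ)^k f(x ρ)^(k+1) = x^k (ρ f(x ρ))^(k+1) = x^k Φ(f)^(k+1).
module Submission where

open import Defs
open import Data.Nat using (ℕ)
open import Data.Rational using (ℚ)
open import Relation.Binary.PropositionalEquality using (_≡_)

open import Algebra.Bundles using (CommutativeMonoid)
import Algebra.Properties.CommutativeSemigroup as CommutativeSemigroupProperties
open import Data.Nat using (zero; suc; _∸_; _≤_; _<_; _≤′_; ≤′-refl; ≤′-step; z≤n; s≤s)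
  renaming (_+_ to _+ℕ_)
import Data.Nat.Properties as ℕ
open import Data.Product using (_,_)
open import Data.Rational using (0ℚ; 1ℚ; _+_; _*_)
open import Data.Rational.Properties
open import Data.Sum using (_⊎_; inj₁; inj₂; [_,_])
open import Level using (0ℓ)
open import Relation.Binary.Bundles using (Setoid)
open import Relation.Binary.PropositionalEquality
  using (refl; sym; trans; cong; cong₂; subst; module ≡-Reasoning)
import Relation.Binary.Reasoning.Setoid as SetoidReasoning
open import Relation.Nullary using (yes; no)

private
  module ℚ+ = CommutativeSemigroupProperties
                (CommutativeMonoid.commutativeSemigroup +-0-commutativeMonoid)
  module ℚ* = CommutativeSemigroupProperties
                (CommutativeMonoid.commutativeSemigroup *-1-commutativeMonoid)

m+n<o+p⇒m<o⊎n<p : ∀ {m n o p} → m +ℕ n < o +ℕ p → m < o ⊎ n < p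
m+n<o+p⇒m<o⊎n<p {m} {o = o} lt with m ℕ.<? o
... | yes m<o = inj₁ m<o
... | no  m≮o = inj₂ (ℕ.≰⇒> (λ p≤n → ℕ.<⇒≱ lt (ℕ.+-mono-≤ (ℕ.≮⇒≥ m≮o) p≤n)))

m∸n<o⇒m<n+o : ∀ {m n o} → n ≤ m → m ∸ n < o → m < n +ℕ o
m∸n<o⇒m<n+o {m} {n} {o} n≤m lt = subst (_< n +ℕ o) (ℕ.m+[n∸m]≡n n≤m) (ℕ.+-monoʳ-< n lt)

-- Finite sums

Σ≤-cong≤ : ∀ n {g h : ℕ → ℚ} → (∀ i → i ≤ n → g i ≡ h i) → Σ≤ n g ≡ Σ≤ n h
Σ≤-cong≤ zero    e = e 0 z≤n
Σ≤-cong≤ (suc n) e =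
  cong₂ _+_ (Σ≤-cong≤ n (λ i i≤n → e i (ℕ.m≤n⇒m≤1+n i≤n))) (e (suc n) ℕ.≤-refl)

Σ≤-cong : ∀ n {g h : ℕ → ℚ} → (∀ i → g i ≡ h i) → Σ≤ n g ≡ Σ≤ n h
Σ≤-cong n e = Σ≤-cong≤ n (λ i _ → e i)

Σ≤-zero : ∀ n {g : ℕ → ℚ} → (∀ i → i ≤ n → g i ≡ 0ℚ) → Σ≤ n g ≡ 0ℚ
Σ≤-zero zero    z = z 0 z≤n
Σ≤-zero (suc n) z =
  trans (cong₂ _+_ (Σ≤-zero n (λ i i≤n → z i (ℕ.m≤n⇒m≤1+n i≤n))) (z (suc n) ℕ.≤-refl))
        (+-identityʳ 0ℚ)

Σ≤-distrib-+ : ∀ n (g h : ℕ → ℚ) → Σ≤ n (λ i → g i + h i) ≡ Σ≤ n g + Σ≤ n h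
Σ≤-distrib-+ zero    g h = refl
Σ≤-distrib-+ (suc n) g h =
  trans (cong (_+ (g (suc n) + h (suc n))) (Σ≤-distrib-+ n g h))
        (ℚ+.interchange (Σ≤ n g) (Σ≤ n h) (g (suc n)) (h (suc n)))

*-distribˡ-Σ≤ : ∀ n c (g : ℕ → ℚ) → c * Σ≤ n g ≡ Σ≤ n (λ i → c * g i)
*-distribˡ-Σ≤ zero    c g = refl
*-distribˡ-Σ≤ (suc n) c g =
  trans (*-distribˡ-+ c (Σ≤ n g) (g (suc n))) (cong (_+ (c * g (suc n))) (*-distribˡ-Σ≤ n c g))

*-distribʳ-Σ≤ : ∀ n (g : ℕ → ℚ) c → Σ≤ n g * c ≡ Σ≤ n (λ i → g i * c)
*-distribʳ-Σ≤ zero    g c = refl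
*-distribʳ-Σ≤ (suc n) g c =
  trans (*-distribʳ-+ c (Σ≤ n g) (g (suc n))) (cong (_+ (g (suc n) * c)) (*-distribʳ-Σ≤ n g c))

*-distribˡ-Σ≤² : ∀ n m c (h : ℕ → ℕ → ℚ) →
                 c * Σ≤ n (λ i → Σ≤ m (h i)) ≡ Σ≤ n (λ i → Σ≤ m (λ j → c * h i j))
*-distribˡ-Σ≤² n m c h =
  trans (*-distribˡ-Σ≤ n c _) (Σ≤-cong n (λ i → *-distribˡ-Σ≤ m c (h i)))

*-distribʳ-Σ≤² : ∀ n m (h : ℕ → ℕ → ℚ) c →
                 Σ≤ n (λ i → Σ≤ m (h i)) * c ≡ Σ≤ n (λ i → Σ≤ m (λ j → h i j * c))
*-distribʳ-Σ≤² n m h c =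
  trans (*-distribʳ-Σ≤ n _ c) (Σ≤-cong n (λ i → *-distribʳ-Σ≤ m (h i) c))

Σ≤-comm : ∀ n m (h : ℕ → ℕ → ℚ) →
          Σ≤ n (λ i → Σ≤ m (h i)) ≡ Σ≤ m (λ j → Σ≤ n (λ i → h i j))
Σ≤-comm zero    m h = refl
Σ≤-comm (suc n) m h =
  trans (cong (_+ Σ≤ m (h (suc n))) (Σ≤-comm n m h))
        (sym (Σ≤-distrib-+ m (λ j → Σ≤ n (λ i → h i j)) (h (suc n))))

Σ≤-suc : ∀ n (g : ℕ → ℚ) → Σ≤ (suc n) g ≡ g 0 + Σ≤ n (λ i → g (suc i))
Σ≤-suc zero    g = refl
Σ≤-suc (suc n) g =
  trans (cong (_+ g (suc (suc n))) (Σ≤-suc n g))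
        (+-assoc (g 0) (Σ≤ n (λ i → g (suc i))) (g (suc (suc n))))

Σ≤-extend : ∀ {n N} (g : ℕ → ℚ) → n ≤ N → (∀ i → n < i → g i ≡ 0ℚ) → Σ≤ N g ≡ Σ≤ n g
Σ≤-extend {n} g n≤N tail = go (ℕ.≤⇒≤′ n≤N)
  where
  go : ∀ {N} → n ≤′ N → Σ≤ N g ≡ Σ≤ n g
  go ≤′-refl                = refl
  go (≤′-step {N} n≤′N) =
    trans (cong₂ _+_ (go n≤′N) (tail (suc N) (s≤s (ℕ.≤′⇒≤ n≤′N)))) (+-identityʳ (Σ≤ n g))

Σ≤-reverse : ∀ n (g : ℕ → ℚ) → Σ≤ n g ≡ Σ≤ n (λ i → g (n ∸ i))
Σ≤-reverse zero    g = refl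
Σ≤-reverse (suc n) g =
  trans (cong (_+ g (suc n)) (Σ≤-reverse n g))
        (trans (+-comm (Σ≤ n (λ i → g (n ∸ i))) (g (suc n)))
               (sym (Σ≤-suc n (λ i → g (suc n ∸ i)))))

Σ≤-triangle : ∀ n (h : ℕ → ℕ → ℚ) →
              Σ≤ n (λ k → Σ≤ k (λ i → h i (k ∸ i))) ≡ Σ≤ n (λ i → Σ≤ (n ∸ i) (h i))
Σ≤-triangle zero    h = refl
Σ≤-triangle (suc n) h = begin
  Σ≤ n (λ k → Σ≤ k (λ i → h i (k ∸ i))) + (Σ≤ n diagonal + h (suc n) (suc n ∸ suc n))
    ≡⟨ cong₂ (λ s d → s + (Σ≤ n diagonal + h (suc n) d)) (Σ≤-triangle n h) (ℕ.n∸n≡0 n) ⟩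
  Σ≤ n (λ i → Σ≤ (n ∸ i) (h i)) + (Σ≤ n diagonal + h (suc n) 0)
    ≡⟨ sym (+-assoc (Σ≤ n (λ i → Σ≤ (n ∸ i) (h i))) (Σ≤ n diagonal) (h (suc n) 0)) ⟩
  (Σ≤ n (λ i → Σ≤ (n ∸ i) (h i)) + Σ≤ n diagonal) + h (suc n) 0
    ≡⟨ cong (_+ h (suc n) 0) (sym (Σ≤-distrib-+ n (λ i → Σ≤ (n ∸ i) (h i)) diagonal)) ⟩
  Σ≤ n (λ i → Σ≤ (n ∸ i) (h i) + diagonal i) + h (suc n) 0
    ≡⟨ cong₂ _+_ (Σ≤-cong≤ n (λ i i≤n → sym (subst (λ l → Σ≤ l (h i) ≡ Σ≤ (n ∸ i) (h i) + h i l)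
                                                    (sym (ℕ.+-∸-assoc 1 i≤n)) refl)))
                 (cong (λ l → Σ≤ l (h (suc n))) (sym (ℕ.n∸n≡0 n))) ⟩
  Σ≤ n (λ i → Σ≤ (suc n ∸ i) (h i)) + Σ≤ (suc n ∸ suc n) (h (suc n)) ∎
  where
  open ≡-Reasoning
  diagonal : ℕ → ℚ
  diagonal i = h i (suc n ∸ i)

Σ≤-triangle₃ : ∀ m (φ : ℕ → ℕ → ℕ → ℚ) →
               Σ≤ m (λ j → Σ≤ j (λ b → φ b (j ∸ b) (m ∸ j)))
               ≡ Σ≤ m (λ b → Σ≤ (m ∸ b) (λ r → φ b r (m ∸ b ∸ r)))
Σ≤-triangle₃ m φ = begin
  Σ≤ m (λ j → Σ≤ j (λ b → φ b (j ∸ b) (m ∸ j)))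
    ≡⟨ Σ≤-cong m (λ j → Σ≤-cong≤ j (λ b b≤j →
         cong (λ l → φ b (j ∸ b) (m ∸ l)) (sym (ℕ.m+[n∸m]≡n b≤j)))) ⟩
  Σ≤ m (λ j → Σ≤ j (λ b → φ b (j ∸ b) (m ∸ (b +ℕ (j ∸ b)))))
    ≡⟨ Σ≤-triangle m (λ b r → φ b r (m ∸ (b +ℕ r))) ⟩
  Σ≤ m (λ b → Σ≤ (m ∸ b) (λ r → φ b r (m ∸ (b +ℕ r))))
    ≡⟨ Σ≤-cong m (λ b → Σ≤-cong (m ∸ b) (λ r → cong (φ b r) (sym (ℕ.∸-+-assoc m b r)))) ⟩
  Σ≤ m (λ b → Σ≤ (m ∸ b) (λ r → φ b r (m ∸ b ∸ r))) ∎
  where open ≡-Reasoning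

Σ≤-antidiagonal-zero : ∀ {a b} n (h : ℕ → ℕ → ℚ) → (∀ i q → i < a ⊎ q < b → h i q ≡ 0ℚ) →
                       n < a +ℕ b → Σ≤ n (λ i → h i (n ∸ i)) ≡ 0ℚ
Σ≤-antidiagonal-zero {a} {b} n h z n<a+b = Σ≤-zero n (λ i i≤n →
  z i (n ∸ i) (m+n<o+p⇒m<o⊎n<p (subst (_< a +ℕ b) (sym (ℕ.m+[n∸m]≡n i≤n)) n<a+b)))

-- The commutative monoid of bivariate series

infix 4 _≈_
_≈_ : Series2 → Series2 → Set
F ≈ G = ∀ n m → F n m ≡ G n m

≈-setoid : Setoid 0ℓ 0ℓ
≈-setoid = record
  { Carrier       = Series2
  ; _≈_           = _≈_
  ; isEquivalence = record
    { refl  = λ n m → refl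
    ; sym   = λ e n m → sym (e n m)
    ; trans = λ e e′ n m → trans (e n m) (e′ n m)
    }
  }

open Setoid ≈-setoid using () renaming (refl to ≈-refl; sym to ≈-sym; trans to ≈-trans)
module ≈-Reasoning = SetoidReasoning ≈-setoid

⊗-cong : ∀ {F F′ G G′} → F ≈ F′ → G ≈ G′ → F ⊗₂ G ≈ F′ ⊗₂ G′
⊗-cong eF eG n m =
  Σ≤-cong n (λ i → Σ≤-cong m (λ j → cong₂ _*_ (eF i j) (eG (n ∸ i) (m ∸ j))))

⊗-congˡ : ∀ F {G G′} → G ≈ G′ → F ⊗₂ G ≈ F ⊗₂ G′
⊗-congˡ F = ⊗-cong {F} (λ n m → refl)

⊗-congʳ : ∀ {F F′} G → F ≈ F′ → F ⊗₂ G ≈ F′ ⊗₂ G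
⊗-congʳ G eF = ⊗-cong {G = G} eF (λ n m → refl)

⊗-comm : ∀ F G → F ⊗₂ G ≈ G ⊗₂ F
⊗-comm F G n m = begin
  Σ≤ n (λ i → Σ≤ m (λ j → F i j * G (n ∸ i) (m ∸ j)))
    ≡⟨ Σ≤-reverse n _ ⟩
  Σ≤ n (λ i → Σ≤ m (λ j → F (n ∸ i) j * G (n ∸ (n ∸ i)) (m ∸ j)))
    ≡⟨ Σ≤-cong n (λ i → Σ≤-reverse m _) ⟩
  Σ≤ n (λ i → Σ≤ m (λ j → F (n ∸ i) (m ∸ j) * G (n ∸ (n ∸ i)) (m ∸ (m ∸ j))))
    ≡⟨ Σ≤-cong≤ n (λ i i≤n → Σ≤-cong≤ m (λ j j≤m →
         trans (cong₂ (λ i′ j′ → F (n ∸ i) (m ∸ j) * G i′ j′) (ℕ.m∸[m∸n]≡n i≤n) (ℕ.m∸[m∸n]≡n j≤m))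
               (*-comm (F (n ∸ i) (m ∸ j)) (G i j)))) ⟩
  Σ≤ n (λ i → Σ≤ m (λ j → G i j * F (n ∸ i) (m ∸ j))) ∎
  where open ≡-Reasoning

⊗-identityˡ : ∀ F → one₂ ⊗₂ F ≈ F
⊗-identityˡ F n m = begin
  Σ≤ n row
    ≡⟨ Σ≤-extend {N = n} row z≤n
         (λ { (suc i) _ → Σ≤-zero m (λ j _ → *-zeroˡ (F (n ∸ suc i) (m ∸ j))) }) ⟩
  Σ≤ m row₀
    ≡⟨ Σ≤-extend {N = m} row₀ z≤n (λ { (suc j) _ → *-zeroˡ (F n (m ∸ suc j)) }) ⟩
  1ℚ * F n m
    ≡⟨ *-identityˡ (F n m) ⟩
  F n m ∎
  where
  open ≡-Reasoning
  row : ℕ → ℚ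
  row i = Σ≤ m (λ j → one₂ i j * F (n ∸ i) (m ∸ j))
  row₀ : ℕ → ℚ
  row₀ j = one₂ 0 j * F n (m ∸ j)

⊗-identityʳ : ∀ F → F ⊗₂ one₂ ≈ F
⊗-identityʳ F = ≈-trans (⊗-comm F one₂) (⊗-identityˡ F)

⊗-assoc : ∀ F G H → (F ⊗₂ G) ⊗₂ H ≈ F ⊗₂ (G ⊗₂ H)
⊗-assoc F G H n m = trans expandˡ (sym expandʳ)
  where
  open ≡-Reasoning
  φ : ℕ → ℕ → ℕ → ℕ → ℕ → ℕ → ℚ
  φ a b q r s t = F a b * G q r * H s t

  triple : ℚ
  triple = Σ≤ n (λ a → Σ≤ (n ∸ a) (λ q → Σ≤ m (λ b → Σ≤ (m ∸ b) (λ r →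
             φ a b q r (n ∸ a ∸ q) (m ∸ b ∸ r)))))

  expandˡ : ((F ⊗₂ G) ⊗₂ H) n m ≡ triple
  expandˡ = begin
    Σ≤ n (λ i → Σ≤ m (λ j → Σ≤ i (λ a → Σ≤ j (λ b → F a b * G (i ∸ a) (j ∸ b))) * H (n ∸ i) (m ∸ j)))
      ≡⟨ Σ≤-cong n (λ i → Σ≤-cong m (λ j → *-distribʳ-Σ≤² i j _ _)) ⟩
    Σ≤ n (λ i → Σ≤ m (λ j → Σ≤ i (λ a → Σ≤ j (λ b → φ a b (i ∸ a) (j ∸ b) (n ∸ i) (m ∸ j)))))
      ≡⟨ Σ≤-cong n (λ i → Σ≤-comm m i _) ⟩
    Σ≤ n (λ i → Σ≤ i (λ a → Σ≤ m (λ j → Σ≤ j (λ b → φ a b (i ∸ a) (j ∸ b) (n ∸ i) (m ∸ j)))))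
      ≡⟨ Σ≤-cong n (λ i → Σ≤-cong i (λ a → Σ≤-triangle₃ m (λ b r t → φ a b (i ∸ a) r (n ∸ i) t))) ⟩
    Σ≤ n (λ i → Σ≤ i (λ a → Σ≤ m (λ b → Σ≤ (m ∸ b) (λ r → φ a b (i ∸ a) r (n ∸ i) (m ∸ b ∸ r)))))
      ≡⟨ Σ≤-triangle₃ n (λ a q s → Σ≤ m (λ b → Σ≤ (m ∸ b) (λ r → φ a b q r s (m ∸ b ∸ r)))) ⟩
    triple ∎

  expandʳ : (F ⊗₂ (G ⊗₂ H)) n m ≡ triple
  expandʳ = begin
    Σ≤ n (λ a → Σ≤ m (λ b → F a b *
      Σ≤ (n ∸ a) (λ q → Σ≤ (m ∸ b) (λ r → G q r * H (n ∸ a ∸ q) (m ∸ b ∸ r)))))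
      ≡⟨ Σ≤-cong n (λ a → Σ≤-cong m (λ b → *-distribˡ-Σ≤² (n ∸ a) (m ∸ b) (F a b)
           (λ q r → G q r * H (n ∸ a ∸ q) (m ∸ b ∸ r)))) ⟩
    Σ≤ n (λ a → Σ≤ m (λ b → Σ≤ (n ∸ a) (λ q → Σ≤ (m ∸ b) (λ r →
      F a b * (G q r * H (n ∸ a ∸ q) (m ∸ b ∸ r))))))
      ≡⟨ Σ≤-cong n (λ a → Σ≤-cong m (λ b → Σ≤-cong (n ∸ a) (λ q → Σ≤-cong (m ∸ b) (λ r →
           sym (*-assoc (F a b) (G q r) _))))) ⟩
    Σ≤ n (λ a → Σ≤ m (λ b → Σ≤ (n ∸ a) (λ q → Σ≤ (m ∸ b) (λ r → φ a b q r (n ∸ a ∸ q) (m ∸ b ∸ r)))))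
      ≡⟨ Σ≤-cong n (λ a → Σ≤-comm m (n ∸ a) _) ⟩
    triple ∎

⊗-commutativeMonoid : CommutativeMonoid 0ℓ 0ℓ
⊗-commutativeMonoid = record
  { Carrier             = Series2
  ; _≈_                 = _≈_
  ; _∙_                 = _⊗₂_
  ; ε                   = one₂
  ; isCommutativeMonoid = record
    { isMonoid = record
      { isSemigroup = record
        { isMagma = record { isEquivalence = Setoid.isEquivalence ≈-setoid ; ∙-cong = ⊗-cong }
        ; assoc   = ⊗-assoc
        }
      ; identity    = ⊗-identityˡ , ⊗-identityʳ
      }
    ; comm     = ⊗-comm
    }
  }

private
  module ⊗ = CommutativeSemigroupProperties
               (CommutativeMonoid.commutativeSemigroup ⊗-commutativeMonoid)

pow₂-cong : ∀ {F G} k → F ≈ G → pow₂ F k ≈ pow₂ G k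
pow₂-cong zero    e = ≈-refl
pow₂-cong (suc k) e = ⊗-cong e (pow₂-cong k e)

pow₂-+ : ∀ F i q → pow₂ F i ⊗₂ pow₂ F q ≈ pow₂ F (i +ℕ q)
pow₂-+ F zero    q = ⊗-identityˡ (pow₂ F q)
pow₂-+ F (suc i) q = ≈-trans (⊗-assoc F (pow₂ F i) (pow₂ F q)) (⊗-congˡ F (pow₂-+ F i q))

pow₂-distrib-⊗ : ∀ F G k → pow₂ (F ⊗₂ G) k ≈ pow₂ F k ⊗₂ pow₂ G k
pow₂-distrib-⊗ F G zero    = ≈-sym (⊗-identityˡ one₂)
pow₂-distrib-⊗ F G (suc k) =
  ≈-trans (⊗-congˡ (F ⊗₂ G) (pow₂-distrib-⊗ F G k)) (⊗.interchange F G (pow₂ F k) (pow₂ G k))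

_·₂_ : ℚ → Series2 → Series2
(c ·₂ F) n m = c * F n m

·₂-cong : ∀ c {F G} → F ≈ G → c ·₂ F ≈ c ·₂ G
·₂-cong c e n m = cong (c *_) (e n m)

⊗-·₂ʳ : ∀ F c G → F ⊗₂ (c ·₂ G) ≈ c ·₂ (F ⊗₂ G)
⊗-·₂ʳ F c G n m =
  trans (Σ≤-cong n (λ i → Σ≤-cong m (λ j → ℚ*.x∙yz≈y∙xz (F i j) c (G (n ∸ i) (m ∸ j)))))
        (sym (*-distribˡ-Σ≤² n m c _))

·₂-⊗-·₂ : ∀ c F d G → (c ·₂ F) ⊗₂ (d ·₂ G) ≈ (c * d) ·₂ (F ⊗₂ G)
·₂-⊗-·₂ c F d G n m =
  trans (Σ≤-cong n (λ i → Σ≤-cong m (λ j → ℚ*.interchange c (F i j) d (G (n ∸ i) (m ∸ j)))))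
        (sym (*-distribˡ-Σ≤² n m (c * d) _))

-- Divisibility by powers of x

infix 4 x^_∣₁_ x^_∣₂_

x^_∣₁_ : ℕ → Series1 → Set
x^ k ∣₁ f = ∀ n → n < k → f n ≡ 0ℚ

x^_∣₂_ : ℕ → Series2 → Set
x^ k ∣₂ F = ∀ n m → n < k → F n m ≡ 0ℚ

x^0∣₁ : ∀ {f} → x^ 0 ∣₁ f
x^0∣₁ n ()

x^0∣₂ : ∀ {F} → x^ 0 ∣₂ F
x^0∣₂ n m ()

x^1∣₁X₁ : x^ 1 ∣₁ X₁
x^1∣₁X₁ zero    _        = refl
x^1∣₁X₁ (suc n) (s≤s ())

x^1∣₂X₂ : x^ 1 ∣₂ X₂
x^1∣₂X₂ zero    m _        = refl
x^1∣₂X₂ (suc n) m (s≤s ())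

x^∣₁-⊗ : ∀ {a b f g} → x^ a ∣₁ f → x^ b ∣₁ g → x^ (a +ℕ b) ∣₁ f ⊗₁ g
x^∣₁-⊗ {f = f} {g} x^a∣f x^b∣g n = Σ≤-antidiagonal-zero n (λ i q → f i * g q)
  (λ i q → [ (λ i<a → trans (cong (_* g q) (x^a∣f i i<a)) (*-zeroˡ (g q)))
           , (λ q<b → trans (cong (f i *_) (x^b∣g q q<b)) (*-zeroʳ (f i))) ])

x^∣₂-⊗ : ∀ {a b F G} → x^ a ∣₂ F → x^ b ∣₂ G → x^ (a +ℕ b) ∣₂ F ⊗₂ G
x^∣₂-⊗ {F = F} {G} x^a∣F x^b∣G n m =
  Σ≤-antidiagonal-zero n (λ i q → Σ≤ m (λ j → F i j * G q (m ∸ j)))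
    (λ i q → [ (λ i<a → Σ≤-zero m (λ j _ →
                 trans (cong (_* G q (m ∸ j)) (x^a∣F i j i<a)) (*-zeroˡ (G q (m ∸ j)))))
             , (λ q<b → Σ≤-zero m (λ j _ →
                 trans (cong (F i j *_) (x^b∣G q (m ∸ j) q<b)) (*-zeroʳ (F i j)))) ])

x^∣₁-pow : ∀ {f} → x^ 1 ∣₁ f → ∀ k → x^ k ∣₁ pow₁ f k
x^∣₁-pow x∣f zero    = x^0∣₁
x^∣₁-pow x∣f (suc k) = x^∣₁-⊗ x∣f (x^∣₁-pow x∣f k)

x^∣₂-pow : ∀ {F} → x^ 1 ∣₂ F → ∀ k → x^ k ∣₂ pow₂ F k
x^∣₂-pow x∣F zero    = x^0∣₂
x^∣₂-pow x∣F (suc k) = x^∣₂-⊗ x∣F (x^∣₂-pow x∣F k)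

x^∣₂-·₂ : ∀ {k F} c → x^ k ∣₂ F → x^ k ∣₂ c ·₂ F
x^∣₂-·₂ c x^k∣F n m n<k = trans (cong (c *_) (x^k∣F n m n<k)) (*-zeroʳ c)

x^∣₂-compose : ∀ {k f} G → x^ k ∣₁ f → x^ k ∣₂ compose f G
x^∣₂-compose G x^k∣f n m n<k = Σ≤-zero n (λ p p≤n →
  trans (cong (_* pow₂ G p n m) (x^k∣f p (ℕ.≤-<-trans p≤n n<k))) (*-zeroˡ (pow₂ G p n m)))

-- [x^n] Σ∞ W only involves W 0, …, W n; this is the sum of W when x^k divides every W k.
Σ∞ : (ℕ → Series2) → Series2
Σ∞ W n m = Σ≤ n (λ k → W k n m)

Σ∞-cong : ∀ {V W} → (∀ k → V k ≈ W k) → Σ∞ V ≈ Σ∞ W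
Σ∞-cong e n m = Σ≤-cong n (λ k → e k n m)

Σ∞-truncate : ∀ {W} → (∀ k → x^ k ∣₂ W k) → ∀ {n N} m → n ≤ N →
              Σ∞ W n m ≡ Σ≤ N (λ k → W k n m)
Σ∞-truncate x^∣W {n} m n≤N = sym (Σ≤-extend _ n≤N (λ k n<k → x^∣W k n m n<k))

⊗-distribˡ-Σ∞ : ∀ V {W} → (∀ k → x^ k ∣₂ W k) → V ⊗₂ Σ∞ W ≈ Σ∞ (λ k → V ⊗₂ W k)
⊗-distribˡ-Σ∞ V {W} x^∣W n m = begin
  Σ≤ n (λ i → Σ≤ m (λ j → V i j * Σ∞ W (n ∸ i) (m ∸ j)))
    ≡⟨ Σ≤-cong n (λ i → Σ≤-cong m (λ j →
         cong (V i j *_) (Σ∞-truncate x^∣W (m ∸ j) (ℕ.m∸n≤m n i)))) ⟩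
  Σ≤ n (λ i → Σ≤ m (λ j → V i j * Σ≤ n (λ k → W k (n ∸ i) (m ∸ j))))
    ≡⟨ Σ≤-cong n (λ i → Σ≤-cong m (λ j → *-distribˡ-Σ≤ n (V i j) _)) ⟩
  Σ≤ n (λ i → Σ≤ m (λ j → Σ≤ n (λ k → V i j * W k (n ∸ i) (m ∸ j))))
    ≡⟨ Σ≤-cong n (λ i → Σ≤-comm m n _) ⟩
  Σ≤ n (λ i → Σ≤ n (λ k → Σ≤ m (λ j → V i j * W k (n ∸ i) (m ∸ j))))
    ≡⟨ Σ≤-comm n n _ ⟩
  Σ≤ n (λ k → Σ≤ n (λ i → Σ≤ m (λ j → V i j * W k (n ∸ i) (m ∸ j)))) ∎
  where open ≡-Reasoning

⊗-distribʳ-Σ∞ : ∀ V {W} → (∀ k → x^ k ∣₂ W k) → Σ∞ W ⊗₂ V ≈ Σ∞ (λ k → W k ⊗₂ V)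
⊗-distribʳ-Σ∞ V {W} x^∣W = begin
  Σ∞ W ⊗₂ V                  ≈⟨ ⊗-comm (Σ∞ W) V ⟩
  V ⊗₂ Σ∞ W                  ≈⟨ ⊗-distribˡ-Σ∞ V x^∣W ⟩
  Σ∞ (λ k → V ⊗₂ W k)        ≈⟨ Σ∞-cong (λ k → ⊗-comm V (W k)) ⟩
  Σ∞ (λ k → W k ⊗₂ V)        ∎
  where open ≈-Reasoning

Σ∞-Σ∞ : ∀ {W : ℕ → ℕ → Series2} → (∀ i q → x^ (i +ℕ q) ∣₂ W i q) → ∀ n m →
        Σ∞ (λ i → Σ∞ (W i)) n m ≡ Σ≤ n (λ k → Σ≤ k (λ i → W i (k ∸ i) n m))
Σ∞-Σ∞ {W} x^∣W n m = begin
  Σ≤ n (λ i → Σ≤ n (λ q → W i q n m))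
    ≡⟨ Σ≤-cong≤ n (λ i i≤n → Σ≤-extend _ (ℕ.m∸n≤m n i) (λ q n∸i<q →
         x^∣W i q n m (m∸n<o⇒m<n+o i≤n n∸i<q))) ⟩
  Σ≤ n (λ i → Σ≤ (n ∸ i) (λ q → W i q n m))
    ≡⟨ sym (Σ≤-triangle n (λ i q → W i q n m)) ⟩
  Σ≤ n (λ k → Σ≤ k (λ i → W i (k ∸ i) n m)) ∎
  where open ≡-Reasoning

-- Substitution into a series divisible by x

compose-one : ∀ G → compose one₁ G ≈ one₂
compose-one G n m =
  trans (Σ≤-extend {N = n} (λ k → one₁ k * pow₂ G k n m) z≤n
                   (λ { (suc k) _ → *-zeroˡ (pow₂ G (suc k) n m) }))
        (*-identityˡ (one₂ n m))

compose-X : ∀ {G} → x^ 1 ∣₂ G → compose X₁ G ≈ G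
compose-X {G} x∣G n m = begin
  Σ≤ n term
    ≡⟨ sym (Σ≤-extend term (ℕ.n≤1+n n) (λ k n<k →
         trans (cong (X₁ k *_) (x^∣₂-pow x∣G k n m n<k)) (*-zeroʳ (X₁ k)))) ⟩
  Σ≤ (suc n) term
    ≡⟨ Σ≤-suc n term ⟩
  term 0 + Σ≤ n (λ k → term (suc k))
    ≡⟨ cong₂ _+_ (*-zeroˡ (one₂ n m))
                 (Σ≤-extend {N = n} (λ k → term (suc k)) z≤n
                   (λ { (suc k) _ → *-zeroˡ (pow₂ G (suc (suc k)) n m) })) ⟩
  0ℚ + 1ℚ * (G ⊗₂ one₂) n m
    ≡⟨ trans (+-identityˡ _) (*-identityˡ _) ⟩
  (G ⊗₂ one₂) n m
    ≡⟨ ⊗-identityʳ G n m ⟩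
  G n m ∎
  where
  open ≡-Reasoning
  term : ℕ → ℚ
  term k = X₁ k * pow₂ G k n m

compose-⊗-expand : ∀ {G} → x^ 1 ∣₂ G → ∀ f g →
                   compose (f ⊗₁ g) G ≈ Σ∞ (λ i → Σ∞ (λ q → (f i * g q) ·₂ pow₂ G (i +ℕ q)))
compose-⊗-expand {G} x∣G f g n m = begin
  Σ≤ n (λ k → Σ≤ k (λ i → f i * g (k ∸ i)) * pow₂ G k n m)
    ≡⟨ Σ≤-cong n (λ k → *-distribʳ-Σ≤ k _ (pow₂ G k n m)) ⟩
  Σ≤ n (λ k → Σ≤ k (λ i → f i * g (k ∸ i) * pow₂ G k n m))
    ≡⟨ Σ≤-cong n (λ k → Σ≤-cong≤ k (λ i i≤k →
         cong (λ l → f i * g (k ∸ i) * pow₂ G l n m) (sym (ℕ.m+[n∸m]≡n i≤k)))) ⟩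
  Σ≤ n (λ k → Σ≤ k (λ i → f i * g (k ∸ i) * pow₂ G (i +ℕ (k ∸ i)) n m))
    ≡⟨ sym (Σ∞-Σ∞ (λ i q → x^∣₂-·₂ (f i * g q) (x^∣₂-pow x∣G (i +ℕ q))) n m) ⟩
  Σ∞ (λ i → Σ∞ (λ q → (f i * g q) ·₂ pow₂ G (i +ℕ q))) n m ∎
  where open ≡-Reasoning

compose-⊗ : ∀ {G} → x^ 1 ∣₂ G → ∀ f g → compose (f ⊗₁ g) G ≈ compose f G ⊗₂ compose g G
compose-⊗ {G} x∣G f g = begin
  compose (f ⊗₁ g) G
    ≈⟨ compose-⊗-expand x∣G f g ⟩
  Σ∞ (λ i → Σ∞ (λ q → (f i * g q) ·₂ pow₂ G (i +ℕ q)))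
    ≈⟨ Σ∞-cong (λ i → Σ∞-cong (λ q → ≈-sym
         (≈-trans (·₂-⊗-·₂ (f i) (pow₂ G i) (g q) (pow₂ G q)) (·₂-cong (f i * g q) (pow₂-+ G i q))))) ⟩
  Σ∞ (λ i → Σ∞ (λ q → (f i ·₂ pow₂ G i) ⊗₂ (g q ·₂ pow₂ G q)))
    ≈⟨ Σ∞-cong (λ i → ≈-sym (⊗-distribˡ-Σ∞ (f i ·₂ pow₂ G i) (x^k∣term g))) ⟩
  Σ∞ (λ i → (f i ·₂ pow₂ G i) ⊗₂ compose g G)
    ≈⟨ ≈-sym (⊗-distribʳ-Σ∞ (compose g G) (x^k∣term f)) ⟩
  compose f G ⊗₂ compose g G ∎
  where
  open ≈-Reasoning
  x^k∣term : ∀ h k → x^ k ∣₂ h k ·₂ pow₂ G k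
  x^k∣term h k = x^∣₂-·₂ (h k) (x^∣₂-pow x∣G k)

compose-pow : ∀ {G} → x^ 1 ∣₂ G → ∀ f k → compose (pow₁ f k) G ≈ pow₂ (compose f G) k
compose-pow {G} x∣G f zero    = compose-one G
compose-pow {G} x∣G f (suc k) =
  ≈-trans (compose-⊗ x∣G f (pow₁ f k)) (⊗-congˡ (compose f G) (compose-pow x∣G f k))

compose-Σ∞ : ∀ G (a : ℕ → ℚ) (t : ℕ → Series1) → (∀ k → x^ k ∣₁ t k) →
             compose (λ p → Σ≤ p (λ k → a k * t k p)) G ≈ Σ∞ (λ k → a k ·₂ compose (t k) G)
compose-Σ∞ G a t x^∣t n m = begin
  Σ≤ n (λ p → Σ≤ p (λ k → a k * t k p) * pow₂ G p n m)
    ≡⟨ Σ≤-cong n (λ p → *-distribʳ-Σ≤ p _ (pow₂ G p n m)) ⟩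
  Σ≤ n (λ p → Σ≤ p (λ k → a k * t k p * pow₂ G p n m))
    ≡⟨ Σ≤-cong≤ n (λ p p≤n → sym (Σ≤-extend _ p≤n (λ k p<k →
         trans (cong (λ c → a k * c * pow₂ G p n m) (x^∣t k p p<k))
               (trans (cong (_* pow₂ G p n m) (*-zeroʳ (a k))) (*-zeroˡ (pow₂ G p n m)))))) ⟩
  Σ≤ n (λ p → Σ≤ n (λ k → a k * t k p * pow₂ G p n m))
    ≡⟨ Σ≤-comm n n _ ⟩
  Σ≤ n (λ k → Σ≤ n (λ p → a k * t k p * pow₂ G p n m))
    ≡⟨ Σ≤-cong n (λ k → trans (Σ≤-cong n (λ p → *-assoc (a k) (t k p) (pow₂ G p n m)))
                              (sym (*-distribˡ-Σ≤ n (a k) _))) ⟩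
  Σ≤ n (λ k → a k * compose (t k) G n m) ∎
  where open ≡-Reasoning

ρ : Series2
ρ = oneMinusX ⊗₂ geomXY

x^1∣argΦ : x^ 1 ∣₂ argΦ
x^1∣argΦ = x^∣₂-⊗ x^1∣₂X₂ (x^0∣₂ {ρ})

Φ-Σ∞ : (a : ℕ → ℚ) (t : ℕ → Series1) → (∀ k → x^ k ∣₁ t k) →
       Φ (λ p → Σ≤ p (λ k → a k * t k p)) ≈ Σ∞ (λ k → a k ·₂ Φ (t k))
Φ-Σ∞ a t x^∣t = begin
  oneMinusX ⊗₂ (geomXY ⊗₂ compose (λ p → Σ≤ p (λ k → a k * t k p)) argΦ)
    ≈⟨ ⊗-congˡ oneMinusX (⊗-congˡ geomXY (compose-Σ∞ argΦ a t x^∣t)) ⟩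
  oneMinusX ⊗₂ (geomXY ⊗₂ Σ∞ (λ k → a k ·₂ C k))
    ≈⟨ ⊗-congˡ oneMinusX (⊗-distribˡ-Σ∞ geomXY x^k∣aC) ⟩
  oneMinusX ⊗₂ Σ∞ (λ k → geomXY ⊗₂ (a k ·₂ C k))
    ≈⟨ ⊗-distribˡ-Σ∞ oneMinusX (λ k → x^∣₂-⊗ (x^0∣₂ {geomXY}) (x^k∣aC k)) ⟩
  Σ∞ (λ k → oneMinusX ⊗₂ (geomXY ⊗₂ (a k ·₂ C k)))
    ≈⟨ Σ∞-cong (λ k → ≈-trans (⊗-congˡ oneMinusX (⊗-·₂ʳ geomXY (a k) (C k)))
                              (⊗-·₂ʳ oneMinusX (a k) (geomXY ⊗₂ C k))) ⟩
  Σ∞ (λ k → a k ·₂ Φ (t k)) ∎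
  where
  open ≈-Reasoning
  C : ℕ → Series2
  C k = compose (t k) argΦ
  x^k∣aC : ∀ k → x^ k ∣₂ a k ·₂ C k
  x^k∣aC k = x^∣₂-·₂ (a k) (x^∣₂-compose argΦ (x^∣t k))

Φ-monomial : ∀ f k → Φ (pow₁ X₁ k ⊗₁ pow₁ f (suc k)) ≈ pow₂ X₂ k ⊗₂ pow₂ (Φ f) (suc k)
Φ-monomial f k = begin
  oneMinusX ⊗₂ (geomXY ⊗₂ compose (pow₁ X₁ k ⊗₁ pow₁ f (suc k)) argΦ)
    ≈⟨ ≈-sym (⊗-assoc oneMinusX geomXY (compose (pow₁ X₁ k ⊗₁ pow₁ f (suc k)) argΦ)) ⟩
  ρ ⊗₂ compose (pow₁ X₁ k ⊗₁ pow₁ f (suc k)) argΦ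
    ≈⟨ ⊗-congˡ ρ (compose-⊗ x^1∣argΦ (pow₁ X₁ k) (pow₁ f (suc k))) ⟩
  ρ ⊗₂ (compose (pow₁ X₁ k) argΦ ⊗₂ compose (pow₁ f (suc k)) argΦ)
    ≈⟨ ⊗-congˡ ρ (⊗-cong (compose-pow x^1∣argΦ X₁ k) (compose-pow x^1∣argΦ f (suc k))) ⟩
  ρ ⊗₂ (pow₂ (compose X₁ argΦ) k ⊗₂ pow₂ C (suc k))
    ≈⟨ ⊗-congˡ ρ (⊗-congʳ (pow₂ C (suc k)) (pow₂-cong k (compose-X x^1∣argΦ))) ⟩
  ρ ⊗₂ (pow₂ (X₂ ⊗₂ ρ) k ⊗₂ pow₂ C (suc k))
    ≈⟨ ⊗-congˡ ρ (⊗-congʳ (pow₂ C (suc k)) (pow₂-distrib-⊗ X₂ ρ k)) ⟩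
  ρ ⊗₂ ((pow₂ X₂ k ⊗₂ pow₂ ρ k) ⊗₂ pow₂ C (suc k))
    ≈⟨ ⊗-congˡ ρ (⊗-assoc (pow₂ X₂ k) (pow₂ ρ k) (pow₂ C (suc k))) ⟩
  ρ ⊗₂ (pow₂ X₂ k ⊗₂ (pow₂ ρ k ⊗₂ pow₂ C (suc k)))
    ≈⟨ ⊗.x∙yz≈y∙xz ρ (pow₂ X₂ k) (pow₂ ρ k ⊗₂ pow₂ C (suc k)) ⟩
  pow₂ X₂ k ⊗₂ (ρ ⊗₂ (pow₂ ρ k ⊗₂ pow₂ C (suc k)))
    ≈⟨ ⊗-congˡ (pow₂ X₂ k) (≈-sym (⊗-assoc ρ (pow₂ ρ k) (pow₂ C (suc k)))) ⟩
  pow₂ X₂ k ⊗₂ (pow₂ ρ (suc k) ⊗₂ pow₂ C (suc k))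
    ≈⟨ ⊗-congˡ (pow₂ X₂ k) (≈-sym (pow₂-distrib-⊗ ρ C (suc k))) ⟩
  pow₂ X₂ k ⊗₂ pow₂ (ρ ⊗₂ C) (suc k)
    ≈⟨ ⊗-congˡ (pow₂ X₂ k) (pow₂-cong (suc k) (⊗-assoc oneMinusX geomXY C)) ⟩
  pow₂ X₂ k ⊗₂ pow₂ (Φ f) (suc k) ∎
  where
  open ≈-Reasoning
  C : Series2
  C = compose f argΦ

lemma1 : (f : Series1) (a : ℕ → ℚ) (n m : ℕ) →
         Φ (lhsSeries a f) n m ≡ rhsSeries a f n m
lemma1 f a = begin
  Φ (lhsSeries a f)                          ≈⟨ Φ-Σ∞ a T x^k∣T ⟩
  Σ∞ (λ k → a k ·₂ Φ (T k))                  ≈⟨ Σ∞-cong (λ k → ·₂-cong (a k) (Φ-monomial f k)) ⟩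
  rhsSeries a f                              ∎
  where
  open ≈-Reasoning
  T : ℕ → Series1
  T k = pow₁ X₁ k ⊗₁ pow₁ f (suc k)
  x^k∣T : ∀ k → x^ k ∣₁ T k
  x^k∣T k = subst (x^_∣₁ T k) (ℕ.+-identityʳ k)
                  (x^∣₁-⊗ (x^∣₁-pow x^1∣₁X₁ k) (x^0∣₁ {pow₁ f (suc k)}))
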